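{- Algorithm 1 (described in the context), provided the solution vectors in its second step are computed correctly, correctly returns the minimum total weight of tardy jobs of the given $1||\sum w_jU_j$ instance.
   Context: In $1||\sum w_jU_j$ the input is $n$ jobs $J=\{1,\ldots,n\}$ with processing times $p_j\in\mathbb{N}$, weights $w_j\in\mathbb{N}$ and due dates $d_j\in\mathbb{N}$; a schedule is a permutation $\sigma$ of the jobs on one machine, completion time $C_j=\sum_{i:\sigma(i)\le\sigma(j)}p_i$, job $j$ tardy if $C_j>d_j$ and early otherwise; the goal is the minimum total weight of tardy jobs. Let $d^{(1)}<\cdots<d^{(d_{\#})}$ be the distinct due dates, $d_{\max}=d^{(d_{\#})}$, and $J_i=\{j: d_j=d^{(i)}\}$. A solution vector for an instance $J'$ with maximum due date $D$ is the integer vector $(A[k])_{k=0}^{D}$ where $A[k]$ is the maximum total weight of a set of jobs of $J'$ of total processing time at most $k$ that can all be early in some schedule of $J'$. For integer vectors $A=(A[k])_{k=0}^m$, $B=(B[\ell])_{\ell=0}^{n'}$ with $m\le n'$, the $(\max,+)$-convolution $A\oplus B$ is the vector $C=(C[\ell])_{\ell=0}^{n'}$ with $C[\ell]=\max_{0\le k\le \ell}(A[k]+B[\ell-k])$ (terms with indices out of range omitted). Algorithm 1: (1) compute $J_1,\ldots,J_{d_{\#}}$; (2) compute solution vectors $A_1,\ldots,A_{d_{\#}}$ for the instances $J_1,\ldots,J_{d_{\#}}$; (3) set $A=A_1$; (4) for $i=2,\ldots,d_{\#}$ set $A=A\oplus A_i$; (5) return $\sum_j w_j-A[d_{\max}]$.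 -}

module Defs where

open import Data.Nat using (ℕ; zero; suc; _+_; _∸_; _≤_; _<_; _⊔_; _⊓_; _<?_; _≟_)
open import Data.Bool using (Bool; true; false; if_then_else_)
open import Data.List using (List; []; _∷_; map; filter)
open import Data.List.Membership.Propositional using (_∈_)
open import Data.List.Relation.Unary.AllPairs using (AllPairs)
open import Data.List.Relation.Binary.Permutation.Propositional using (_↭_)
open import Data.Product using (Σ; ∃; _×_; _,_; proj₁; proj₂)
open import Data.Unit using (⊤)
open import Relation.Nullary using (does)
open import Relation.Binary.PropositionalEquality using (_≡_)

record Job : Set where
  constructor job
  field
    p w d : ℕ
open Job public

-- An instance is a list of jobs (a multiset); a schedule of an instance J
-- is a list τ with τ ↭ J (jobs processed in list order, starting at time 0).

tardyWeight : ℕ → List Job → ℕ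
tardyWeight t [] = 0
tardyWeight t (j ∷ js) =
  (if does (d j <? (t + p j)) then w j else 0) + tardyWeight (t + p j) js

totalWeight : List Job → ℕ
totalWeight [] = 0
totalWeight (j ∷ js) = w j + totalWeight js

IsOptimum : List Job → ℕ → Set
IsOptimum J v =
  (Σ (List Job) λ τ → (τ ↭ J) × (tardyWeight 0 τ ≡ v)) ×
  ((τ : List Job) → τ ↭ J → v ≤ tardyWeight 0 τ)

-- A schedule in which some jobs are marked (the marked jobs form a set S).
-- All marked jobs early, starting at time t:
MarkedEarly : ℕ → List (Job × Bool) → Set
MarkedEarly t [] = ⊤
MarkedEarly t ((j , true) ∷ ms) = (t + p j ≤ d j) × MarkedEarly (t + p j) ms
MarkedEarly t ((j , false) ∷ ms) = MarkedEarly (t + p j) ms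

selP : List (Job × Bool) → ℕ
selP [] = 0
selP ((j , true) ∷ ms) = p j + selP ms
selP ((j , false) ∷ ms) = selP ms

selW : List (Job × Bool) → ℕ
selW [] = 0
selW ((j , true) ∷ ms) = w j + selW ms
selW ((j , false) ∷ ms) = selW ms

-- Vectors (A[k])_{k=0}^{D} are represented as functions ℕ → ℕ of which
-- only the entries 0..D are meaningful (the length is carried separately).
IsSolutionVector : List Job → ℕ → (ℕ → ℕ) → Set
IsSolutionVector J' D A = (k : ℕ) → k ≤ D →
  (Σ (List (Job × Bool)) λ ms → (map proj₁ ms ↭ J') × MarkedEarly 0 ms
      × (selP ms ≤ k) × (selW ms ≡ A k)) ×
  ((ms : List (Job × Bool)) → map proj₁ ms ↭ J' → MarkedEarly 0 ms →
      selP ms ≤ k → selW ms ≤ A k)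

jobsWithDue : List Job → ℕ → List Job
jobsWithDue J x = filter (λ j → d j ≟ x) J

IsDistinctDueDates : List Job → List ℕ → Set
IsDistinctDueDates J ds = AllPairs _<_ ds ×
  ((x : ℕ) → x ∈ ds → x ∈ map d J) × ((x : ℕ) → x ∈ map d J → x ∈ ds)

maxUpTo : ℕ → (ℕ → ℕ) → ℕ
maxUpTo zero f = f 0
maxUpTo (suc n) f = maxUpTo n f ⊔ f (suc n)

maxPlusConv : (m : ℕ) → (ℕ → ℕ) → (ℕ → ℕ) → (ℕ → ℕ)
maxPlusConv m A B ℓ = maxUpTo (ℓ ⊓ m) (λ k → A k + B (ℓ ∸ k))

-- Step (4): A holds a vector with last index m; fold over remaining due dates.
-- sol x is the solution vector computed in step (2) for J_i with d^(i) = x.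
convLoop : (ℕ → ℕ → ℕ) → ℕ → (ℕ → ℕ) → List ℕ → ℕ × (ℕ → ℕ)
convLoop sol m A [] = m , A
convLoop sol m A (x ∷ xs) = convLoop sol x (maxPlusConv m A (sol x)) xs

algorithm1 : List Job → ℕ → List ℕ → (ℕ → ℕ → ℕ) → ℕ
algorithm1 J d₁ ds sol =
  totalWeight J ∸ proj₂ (convLoop sol d₁ (sol d₁) ds) (proj₁ (convLoop sol d₁ (sol d₁) ds))

-- Call S ⊆ J′ an early subset if its jobs can all be early in some schedule of J′; a solution
-- vector records, for each load bound k, the maximum weight of an early subset of load ≤ k.
-- Let m < x be consecutive due dates. An early subset of J≤m ∪ Jₓ splits into its jobs due by m,
-- an early subset of J≤m of some load k ≤ m, and jobs of Jₓ, which all stay early behind them as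
-- long as the total load is at most x; conversely any two such sets combine. This is exactly the
-- (max,+)-convolution, so the loop maintains the solution vector of the jobs due by the current
-- due date. Finally, the early jobs of any schedule form an early subset, while running an
-- optimal early subset first leaves only its complement tardy; hence the optimum is
-- Σ wⱼ − A[d_max].

module Submission where

open import Defs
open import Data.Nat using (ℕ; _<ᵇ_; zero; suc; _+_; _∸_; _≤_; _<_; _⊓_; _≤?_; _≟_; z≤n; s≤s⁻¹)
open import Data.Nat.Properties
open import Data.Nat.ListAction using (sum)
open import Data.Nat.ListAction.Properties using (sum-++; sum-↭)
open import Data.Bool using (Bool; true; false; not)
open import Data.List using (List; []; _∷_; _++_; map; filter; concatMap)
open import Data.List.Properties using (map-++; filter-++; filter-all; filter-none; filter-accept; filter-reject; ++-assoc; ++-identityʳ)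
open import Data.List.Membership.Propositional using (_∈_; _∉_)
open import Data.List.Membership.Propositional.Properties using (∈-map⁺)
open import Data.List.Relation.Unary.All as All using (All; []; _∷_)
open import Data.List.Relation.Unary.All.Properties as All using (all-filter; ++⁻ˡ)
open import Data.List.Relation.Unary.Any using (here; there)
open import Data.List.Relation.Unary.AllPairs as AllPairs using (AllPairs; _∷_)
open import Data.List.Relation.Unary.Unique.Propositional using (Unique)
open import Data.List.Relation.Binary.Permutation.Propositional
  using (_↭_; ↭-refl; ↭-sym; ↭-trans; ↭-reflexive; prep; module PermutationReasoning)
open import Data.List.Relation.Binary.Permutation.Propositional.Properties
  using (All-resp-↭; filter-↭; map⁺; shift; shifts; ++⁺; ++⁺ˡ)
open import Data.Product using (Σ-syntax; ∃-syntax; _×_; _,_; proj₁; proj₂)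
open import Data.Sum using (inj₁; inj₂)
open import Data.Unit using (⊤; tt)
open import Function using (_∘_)
open import Relation.Nullary using (¬_; yes; no; contradiction)
open import Relation.Nullary.Reflects using (ofʸ; ofⁿ)
open import Relation.Unary using (Pred; Decidable; ∁)
open import Relation.Unary.Properties using (∁?)
open import Relation.Binary.PropositionalEquality
  using (_≡_; _≢_; refl; sym; trans; cong; cong₂; subst; module ≡-Reasoning)

maxUpTo-upper : ∀ n f {k} → k ≤ n → f k ≤ maxUpTo n f
maxUpTo-upper zero f z≤n = ≤-refl
maxUpTo-upper (suc n) f {k} k≤1+n with k ≟ suc n
... | yes refl = m≤n⊔m (maxUpTo n f) (f (suc n))
... | no k≢1+n = ≤-trans (maxUpTo-upper n f (s≤s⁻¹ (≤∧≢⇒< k≤1+n k≢1+n))) (m≤m⊔n _ _)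

maxUpTo-attained : ∀ n f → ∃[ k ] k ≤ n × maxUpTo n f ≡ f k
maxUpTo-attained zero f = 0 , z≤n , refl
maxUpTo-attained (suc n) f with maxUpTo-attained n f | ≤-total (maxUpTo n f) (f (suc n))
... | _ , _ , _    | inj₁ max≤last = suc n , ≤-refl , m≤n⇒m⊔n≡n max≤last
... | k , k≤n , eq | inj₂ last≤max = k , m≤n⇒m≤1+n k≤n , trans (m≥n⇒m⊔n≡m last≤max) eq

sum-map-++ : ∀ {a} {A : Set a} (f : A → ℕ) xs ys →
  sum (map f (xs ++ ys)) ≡ sum (map f xs) + sum (map f ys)
sum-map-++ f xs ys = trans (cong sum (map-++ f xs ys)) (sum-++ (map f xs) (map f ys))

sum-map-↭ : ∀ {a} {A : Set a} (f : A → ℕ) {xs ys} → xs ↭ ys → sum (map f xs) ≡ sum (map f ys)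
sum-map-↭ f = sum-↭ ∘ map⁺ f

filter-++-filter-∁-↭ : ∀ {a ℓ} {A : Set a} {P : Pred A ℓ} (P? : Decidable P) xs →
  filter P? xs ++ filter (∁? P?) xs ↭ xs
filter-++-filter-∁-↭ P? [] = ↭-refl
filter-++-filter-∁-↭ P? (x ∷ xs) with P? x
... | yes _ = prep x (filter-++-filter-∁-↭ P? xs)
... | no _ = ↭-trans (shift x (filter P? xs) _) (prep x (filter-++-filter-∁-↭ P? xs))

load weight : List Job → ℕ
load S = sum (map p S)
weight S = sum (map w S)

totalWeight≡weight : ∀ S → totalWeight S ≡ weight S
totalWeight≡weight [] = refl
totalWeight≡weight (j ∷ S) = cong (w j +_) (totalWeight≡weight S)

EarlyFrom : ℕ → List Job → Set
EarlyFrom t [] = ⊤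
EarlyFrom t (j ∷ S) = t + p j ≤ d j × EarlyFrom (t + p j) S

EarlyFrom-++ : ∀ t S T → EarlyFrom t S → EarlyFrom (t + load S) T → EarlyFrom t (S ++ T)
EarlyFrom-++ t [] T _ early = subst (λ s → EarlyFrom s T) (+-identityʳ t) early
EarlyFrom-++ t (j ∷ S) T (onTime , early) earlyT =
  onTime , EarlyFrom-++ (t + p j) S T early (subst (λ s → EarlyFrom s T) (sym (+-assoc t (p j) (load S))) earlyT)

EarlyFrom-commonDue : ∀ {x} t S → All (λ j → d j ≡ x) S → t + load S ≤ x → EarlyFrom t S
EarlyFrom-commonDue t [] [] _ = tt
EarlyFrom-commonDue t (j ∷ S) (refl ∷ due≡) done≤ =
  ≤-trans (m≤m+n (t + p j) (load S)) done≤′ , EarlyFrom-commonDue (t + p j) S due≡ done≤′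
  where
  done≤′ : t + p j + load S ≤ d j
  done≤′ = subst (_≤ d j) (sym (+-assoc t (p j) (load S))) done≤

EarlyFrom⇒load≤ : ∀ {D} t S → All (λ j → d j ≤ D) S → t ≤ D → EarlyFrom t S → t + load S ≤ D
EarlyFrom⇒load≤ {D} t [] [] t≤D _ = subst (_≤ D) (sym (+-identityʳ t)) t≤D
EarlyFrom⇒load≤ {D} t (j ∷ S) (due≤D ∷ dues≤D) _ (onTime , early) =
  subst (_≤ D) (+-assoc t (p j) (load S))
    (EarlyFrom⇒load≤ (t + p j) S dues≤D (≤-trans onTime due≤D) early)

EarlyFrom-filter : ∀ {ℓ} {P : Pred Job ℓ} (P? : Decidable P) {s t} S →
  s ≤ t → EarlyFrom t S → EarlyFrom s (filter P? S)
EarlyFrom-filter P? [] _ _ = tt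
EarlyFrom-filter P? {s} {t} (j ∷ S) s≤t (onTime , early) with P? j
... | yes _ = ≤-trans (+-monoˡ-≤ (p j) s≤t) onTime , EarlyFrom-filter P? S (+-monoˡ-≤ (p j) s≤t) early
... | no _ = EarlyFrom-filter P? S (≤-trans s≤t (m≤m+n t (p j))) early

-- The test `does (d j <? t + p j)` in tardyWeight normalises to `d j <ᵇ t + p j`, which is
-- therefore what the proofs below abstract over.
tardyWeight≤weight : ∀ t τ → tardyWeight t τ ≤ weight τ
tardyWeight≤weight t [] = z≤n
tardyWeight≤weight t (j ∷ τ) with d j <ᵇ t + p j
... | true = +-monoʳ-≤ (w j) (tardyWeight≤weight (t + p j) τ)
... | false = ≤-trans (tardyWeight≤weight (t + p j) τ) (m≤n+m _ (w j))

tardyWeight-++-≤ : ∀ t S U → EarlyFrom t S → tardyWeight t (S ++ U) ≤ weight U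
tardyWeight-++-≤ t [] U _ = tardyWeight≤weight t U
tardyWeight-++-≤ t (j ∷ S) U (onTime , early)
  with d j <ᵇ t + p j | <ᵇ-reflects-< (d j) (t + p j)
... | true | ofʸ late = contradiction onTime (<⇒≱ late)
... | false | _ = tardyWeight-++-≤ (t + p j) S U early

-- The paper's "S can all be early in some schedule of J′": dropping the other jobs of such a
-- schedule only moves S earlier, so S may be assumed to run first, in list order.
EarlySubset : List Job → List Job → Set
EarlySubset J′ S = Σ[ U ∈ List Job ] (S ++ U ↭ J′) × EarlyFrom 0 S

EarlySubset-All : ∀ {ℓ} {P : Pred Job ℓ} {J′ S} → All P J′ → EarlySubset J′ S → All P S
EarlySubset-All {S = S} all (_ , perm , _) = ++⁻ˡ S (All-resp-↭ (↭-sym perm) all)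

EarlySubset-resp-↭ : ∀ {J′ J″ S} → J′ ↭ J″ → EarlySubset J′ S → EarlySubset J″ S
EarlySubset-resp-↭ J′↭J″ (U , perm , early) = U , ↭-trans perm J′↭J″ , early

EarlySubset-filter : ∀ {ℓ} {P : Pred Job ℓ} (P? : Decidable P) {J′ S} →
  EarlySubset J′ S → EarlySubset (filter P? J′) (filter P? S)
EarlySubset-filter P? {S = S} (U , perm , early) =
  filter P? U ,
  ↭-trans (↭-reflexive (sym (filter-++ P? S U))) (filter-↭ P? perm) ,
  EarlyFrom-filter P? S z≤n early

EarlySubset-separate : ∀ {ℓ} {P : Pred Job ℓ} (P? : Decidable P) {J₁ J₂ S} →
  All P J₁ → All (∁ P) J₂ → EarlySubset (J₁ ++ J₂) S →
  EarlySubset J₁ (filter P? S) × EarlySubset J₂ (filter (∁? P?) S)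
EarlySubset-separate P? {J₁} {J₂} {S} all₁ none₂ early =
  subst (λ I → EarlySubset I (filter P? S)) J₁-part (EarlySubset-filter P? early) ,
  subst (λ I → EarlySubset I (filter (∁? P?) S)) J₂-part (EarlySubset-filter (∁? P?) early)
  where
  open ≡-Reasoning
  J₁-part : filter P? (J₁ ++ J₂) ≡ J₁
  J₁-part = begin
    filter P? (J₁ ++ J₂)           ≡⟨ filter-++ P? J₁ J₂ ⟩
    filter P? J₁ ++ filter P? J₂   ≡⟨ cong₂ _++_ (filter-all P? all₁) (filter-none P? none₂) ⟩
    J₁ ++ []                       ≡⟨ ++-identityʳ J₁ ⟩
    J₁                             ∎
  J₂-part : filter (∁? P?) (J₁ ++ J₂) ≡ J₂
  J₂-part = begin
    filter (∁? P?) (J₁ ++ J₂)                ≡⟨ filter-++ (∁? P?) J₁ J₂ ⟩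
    filter (∁? P?) J₁ ++ filter (∁? P?) J₂   ≡⟨ cong₂ _++_ (filter-none (∁? P?) (All.map (λ Pj ¬Pj → ¬Pj Pj) all₁))
                                                            (filter-all (∁? P?) none₂) ⟩
    J₂                                       ∎

EarlySubset-++-commonDue : ∀ {x J₁ J₂ S₁ S₂} → All (λ j → d j ≡ x) J₂ → load S₁ + load S₂ ≤ x →
  EarlySubset J₁ S₁ → EarlySubset J₂ S₂ → EarlySubset (J₁ ++ J₂) (S₁ ++ S₂)
EarlySubset-++-commonDue {J₁ = J₁} {J₂} {S₁} {S₂} dues≡x done≤x
  early₁@(U₁ , perm₁ , onTime₁) early₂@(U₂ , perm₂ , _) =
  U₁ ++ U₂ , perm , EarlyFrom-++ 0 S₁ S₂ onTime₁ (EarlyFrom-commonDue (load S₁) S₂ (EarlySubset-All dues≡x early₂) done≤x)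
  where
  open PermutationReasoning
  perm : (S₁ ++ S₂) ++ U₁ ++ U₂ ↭ J₁ ++ J₂
  perm = begin
    (S₁ ++ S₂) ++ U₁ ++ U₂ ≡⟨ ++-assoc S₁ S₂ (U₁ ++ U₂) ⟩
    S₁ ++ S₂ ++ U₁ ++ U₂   ↭⟨ ++⁺ˡ S₁ (shifts S₂ U₁) ⟩
    S₁ ++ U₁ ++ S₂ ++ U₂   ≡⟨ ++-assoc S₁ U₁ (S₂ ++ U₂) ⟨
    (S₁ ++ U₁) ++ S₂ ++ U₂ ↭⟨ ++⁺ perm₁ perm₂ ⟩
    J₁ ++ J₂               ∎

MaxEarlyWeight : List Job → ℕ → (ℕ → ℕ) → Set
MaxEarlyWeight J′ D A = ∀ k → k ≤ D →
  (Σ[ S ∈ List Job ] EarlySubset J′ S × load S ≤ k × weight S ≡ A k) ×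
  (∀ S → EarlySubset J′ S → load S ≤ k → weight S ≤ A k)

MaxEarlyWeight-resp-↭ : ∀ {J′ J″ D A} → J′ ↭ J″ → MaxEarlyWeight J′ D A → MaxEarlyWeight J″ D A
MaxEarlyWeight-resp-↭ J′↭J″ opt k k≤D with opt k k≤D
... | (S , early , load≤k , weight≡) , optimal =
  (S , EarlySubset-resp-↭ J′↭J″ early , load≤k , weight≡) ,
  λ S early → optimal S (EarlySubset-resp-↭ (↭-sym J′↭J″) early)

marked unmarked : List (Job × Bool) → List Job
marked [] = []
marked ((j , true) ∷ ms) = j ∷ marked ms
marked ((j , false) ∷ ms) = marked ms
unmarked [] = []
unmarked ((j , true) ∷ ms) = unmarked ms
unmarked ((j , false) ∷ ms) = j ∷ unmarked ms

marked-++-unmarked : ∀ ms → marked ms ++ unmarked ms ↭ map proj₁ ms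
marked-++-unmarked [] = ↭-refl
marked-++-unmarked ((j , true) ∷ ms) = prep j (marked-++-unmarked ms)
marked-++-unmarked ((j , false) ∷ ms) = ↭-trans (shift j (marked ms) (unmarked ms)) (prep j (marked-++-unmarked ms))

selP≡load-marked : ∀ ms → selP ms ≡ load (marked ms)
selP≡load-marked [] = refl
selP≡load-marked ((j , true) ∷ ms) = cong (p j +_) (selP≡load-marked ms)
selP≡load-marked ((j , false) ∷ ms) = selP≡load-marked ms

selW≡weight-marked : ∀ ms → selW ms ≡ weight (marked ms)
selW≡weight-marked [] = refl
selW≡weight-marked ((j , true) ∷ ms) = cong (w j +_) (selW≡weight-marked ms)
selW≡weight-marked ((j , false) ∷ ms) = selW≡weight-marked ms

MarkedEarly⇒EarlyFrom-marked : ∀ {s t} ms → s ≤ t → MarkedEarly t ms → EarlyFrom s (marked ms)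
MarkedEarly⇒EarlyFrom-marked [] _ _ = tt
MarkedEarly⇒EarlyFrom-marked ((j , true) ∷ ms) s≤t (onTime , early) =
  ≤-trans (+-monoˡ-≤ (p j) s≤t) onTime , MarkedEarly⇒EarlyFrom-marked ms (+-monoˡ-≤ (p j) s≤t) early
MarkedEarly⇒EarlyFrom-marked {t = t} ((j , false) ∷ ms) s≤t early =
  MarkedEarly⇒EarlyFrom-marked ms (≤-trans s≤t (m≤m+n t (p j))) early

EarlySubset-marked : ∀ {J′} ms → map proj₁ ms ↭ J′ → MarkedEarly 0 ms → EarlySubset J′ (marked ms)
EarlySubset-marked ms perm early =
  unmarked ms , ↭-trans (marked-++-unmarked ms) perm , MarkedEarly⇒EarlyFrom-marked ms z≤n early

markFront : List Job → List Job → List (Job × Bool)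
markFront S U = map (_, true) S ++ map (_, false) U

map-proj₁-markFront : ∀ S U → map proj₁ (markFront S U) ≡ S ++ U
map-proj₁-markFront [] [] = refl
map-proj₁-markFront [] (j ∷ U) = cong (j ∷_) (map-proj₁-markFront [] U)
map-proj₁-markFront (j ∷ S) U = cong (j ∷_) (map-proj₁-markFront S U)

marked-markFront : ∀ S U → marked (markFront S U) ≡ S
marked-markFront [] [] = refl
marked-markFront [] (j ∷ U) = marked-markFront [] U
marked-markFront (j ∷ S) U = cong (j ∷_) (marked-markFront S U)

EarlyFrom⇒MarkedEarly-markFront : ∀ t S U → EarlyFrom t S → MarkedEarly t (markFront S U)
EarlyFrom⇒MarkedEarly-markFront t [] [] _ = tt
EarlyFrom⇒MarkedEarly-markFront t [] (j ∷ U) _ = EarlyFrom⇒MarkedEarly-markFront (t + p j) [] U tt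
EarlyFrom⇒MarkedEarly-markFront t (j ∷ S) U (onTime , early) =
  onTime , EarlyFrom⇒MarkedEarly-markFront (t + p j) S U early

isSolutionVector⇒maxEarlyWeight : ∀ {J′ D A} → IsSolutionVector J′ D A → MaxEarlyWeight J′ D A
isSolutionVector⇒maxEarlyWeight {J′} {A = A} sv k k≤D with sv k k≤D
... | (ms , perm , early , selP≤k , selW≡) , optimal = attained , bounded
  where
  attained : Σ[ S ∈ List Job ] EarlySubset J′ S × load S ≤ k × weight S ≡ A k
  attained = marked ms , EarlySubset-marked ms perm early ,
             subst (_≤ k) (selP≡load-marked ms) selP≤k , trans (sym (selW≡weight-marked ms)) selW≡
  bounded : ∀ S → EarlySubset J′ S → load S ≤ k → weight S ≤ A k
  bounded S (U , perm′ , early′) load≤k =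
    subst (_≤ A k) selW≡weight
      (optimal ms′ (subst (_↭ J′) (sym (map-proj₁-markFront S U)) perm′)
         (EarlyFrom⇒MarkedEarly-markFront 0 S U early′) (subst (_≤ k) (sym selP≡load) load≤k))
    where
    ms′ : List (Job × Bool)
    ms′ = markFront S U
    selP≡load : selP ms′ ≡ load S
    selP≡load = trans (selP≡load-marked ms′) (cong load (marked-markFront S U))
    selW≡weight : selW ms′ ≡ weight S
    selW≡weight = trans (selW≡weight-marked ms′) (cong weight (marked-markFront S U))

module MaxPlusConvolution
  {J₁ J₂ : List Job} {m x : ℕ} {A B : ℕ → ℕ} (m<x : m < x)
  (dues≤m : All (λ j → d j ≤ m) J₁) (dues≡x : All (λ j → d j ≡ x) J₂)
  (optA : MaxEarlyWeight J₁ m A) (optB : MaxEarlyWeight J₂ x B)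
  where

  attained : ∀ ℓ → ℓ ≤ x →
    Σ[ S ∈ List Job ] EarlySubset (J₁ ++ J₂) S × load S ≤ ℓ × weight S ≡ maxPlusConv m A B ℓ
  attained ℓ ℓ≤x with maxUpTo-attained (ℓ ⊓ m) (λ k → A k + B (ℓ ∸ k))
  ... | k , k≤ℓ⊓m , max≡
    with proj₁ (optA k (≤-trans k≤ℓ⊓m (m⊓n≤n ℓ m)))
       | proj₁ (optB (ℓ ∸ k) (≤-trans (m∸n≤m ℓ k) ℓ≤x))
  ... | S₁ , early₁ , load₁≤ , weight₁≡ | S₂ , early₂ , load₂≤ , weight₂≡ =
    S₁ ++ S₂ ,
    EarlySubset-++-commonDue dues≡x (≤-trans load≤ℓ ℓ≤x) early₁ early₂ ,
    subst (_≤ ℓ) (sym (sum-map-++ p S₁ S₂)) load≤ℓ ,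
    weight≡
    where
    open ≡-Reasoning
    load≤ℓ : load S₁ + load S₂ ≤ ℓ
    load≤ℓ = ≤-trans (+-mono-≤ load₁≤ load₂≤) (≤-reflexive (m+[n∸m]≡n (≤-trans k≤ℓ⊓m (m⊓n≤m ℓ m))))
    weight≡ : weight (S₁ ++ S₂) ≡ maxPlusConv m A B ℓ
    weight≡ = begin
      weight (S₁ ++ S₂)       ≡⟨ sum-map-++ w S₁ S₂ ⟩
      weight S₁ + weight S₂   ≡⟨ cong₂ _+_ weight₁≡ weight₂≡ ⟩
      A k + B (ℓ ∸ k)         ≡⟨ max≡ ⟨
      maxPlusConv m A B ℓ     ∎

  bounded : ∀ ℓ → ℓ ≤ x → ∀ S → EarlySubset (J₁ ++ J₂) S → load S ≤ ℓ → weight S ≤ maxPlusConv m A B ℓ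
  bounded ℓ ℓ≤x S early load≤ℓ = begin
    weight S                 ≡⟨ split w ⟩
    weight S₁ + weight S₂    ≤⟨ +-mono-≤ (proj₂ (optA k k≤m) S₁ early₁ ≤-refl)
                                         (proj₂ (optB (ℓ ∸ k) (≤-trans (m∸n≤m ℓ k) ℓ≤x)) S₂ early₂ load₂≤) ⟩
    A k + B (ℓ ∸ k)          ≤⟨ maxUpTo-upper (ℓ ⊓ m) (λ k → A k + B (ℓ ∸ k)) (⊓-glb k≤ℓ k≤m) ⟩
    maxPlusConv m A B ℓ      ∎
    where
    open ≤-Reasoning
    due≤m? : Decidable (λ j → d j ≤ m)
    due≤m? j = d j ≤? m
    S₁ S₂ : List Job
    S₁ = filter due≤m? S
    S₂ = filter (∁? due≤m?) S
    J₂-late : All (λ j → ¬ d j ≤ m) J₂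
    J₂-late = All.map (λ { refl → <⇒≱ m<x }) dues≡x
    early₁ : EarlySubset J₁ S₁
    early₁ = proj₁ (EarlySubset-separate due≤m? dues≤m J₂-late early)
    early₂ : EarlySubset J₂ S₂
    early₂ = proj₂ (EarlySubset-separate due≤m? dues≤m J₂-late early)
    split : ∀ f → sum (map f S) ≡ sum (map f S₁) + sum (map f S₂)
    split f = trans (sum-map-↭ f (↭-sym (filter-++-filter-∁-↭ due≤m? S))) (sum-map-++ f S₁ S₂)
    k : ℕ
    k = load S₁
    k≤m : k ≤ m
    k≤m = EarlyFrom⇒load≤ 0 S₁ (EarlySubset-All dues≤m early₁) z≤n (proj₂ (proj₂ early₁))
    loads≤ℓ : k + load S₂ ≤ ℓ
    loads≤ℓ = subst (_≤ ℓ) (split p) load≤ℓ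
    k≤ℓ : k ≤ ℓ
    k≤ℓ = ≤-trans (m≤m+n k (load S₂)) loads≤ℓ
    load₂≤ : load S₂ ≤ ℓ ∸ k
    load₂≤ = m+n≤o⇒m≤o∸n (load S₂) (subst (_≤ ℓ) (+-comm k (load S₂)) loads≤ℓ)

maxPlusConv-maxEarlyWeight : ∀ {J₁ J₂ m x A B} → m < x →
  All (λ j → d j ≤ m) J₁ → All (λ j → d j ≡ x) J₂ →
  MaxEarlyWeight J₁ m A → MaxEarlyWeight J₂ x B → MaxEarlyWeight (J₁ ++ J₂) x (maxPlusConv m A B)
maxPlusConv-maxEarlyWeight m<x dues≤m dues≡x optA optB ℓ ℓ≤x =
  attained ℓ ℓ≤x , bounded ℓ ℓ≤x
  where open MaxPlusConvolution m<x dues≤m dues≡x optA optB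

onTimeMarking : ℕ → List Job → List (Job × Bool)
onTimeMarking t [] = []
onTimeMarking t (j ∷ τ) = (j , not (d j <ᵇ t + p j)) ∷ onTimeMarking (t + p j) τ

map-proj₁-onTimeMarking : ∀ t τ → map proj₁ (onTimeMarking t τ) ≡ τ
map-proj₁-onTimeMarking t [] = refl
map-proj₁-onTimeMarking t (j ∷ τ) = cong (j ∷_) (map-proj₁-onTimeMarking (t + p j) τ)

MarkedEarly-onTimeMarking : ∀ t τ → MarkedEarly t (onTimeMarking t τ)
MarkedEarly-onTimeMarking t [] = tt
MarkedEarly-onTimeMarking t (j ∷ τ)
  with d j <ᵇ t + p j | <ᵇ-reflects-< (d j) (t + p j)
... | true | _ = MarkedEarly-onTimeMarking (t + p j) τ
... | false | ofⁿ onTime = ≮⇒≥ onTime , MarkedEarly-onTimeMarking (t + p j) τ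

weight-unmarked-onTimeMarking : ∀ t τ → weight (unmarked (onTimeMarking t τ)) ≡ tardyWeight t τ
weight-unmarked-onTimeMarking t [] = refl
weight-unmarked-onTimeMarking t (j ∷ τ) with d j <ᵇ t + p j
... | true = cong (w j +_) (weight-unmarked-onTimeMarking (t + p j) τ)
... | false = weight-unmarked-onTimeMarking (t + p j) τ

schedule⇒earlySubset : ∀ {J′} τ → τ ↭ J′ →
  Σ[ E ∈ List Job ] EarlySubset J′ E × weight J′ ≡ weight E + tardyWeight 0 τ
schedule⇒earlySubset {J′} τ perm = marked ms , EarlySubset-marked ms ms↭J′ (MarkedEarly-onTimeMarking 0 τ) , split
  where
  open ≡-Reasoning
  ms : List (Job × Bool)
  ms = onTimeMarking 0 τ
  ms↭J′ : map proj₁ ms ↭ J′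
  ms↭J′ = subst (_↭ J′) (sym (map-proj₁-onTimeMarking 0 τ)) perm
  split : weight J′ ≡ weight (marked ms) + tardyWeight 0 τ
  split = begin
    weight J′                                      ≡⟨ sum-map-↭ w (↭-trans (marked-++-unmarked ms) ms↭J′) ⟨
    weight (marked ms ++ unmarked ms)              ≡⟨ sum-map-++ w (marked ms) (unmarked ms) ⟩
    weight (marked ms) + weight (unmarked ms)      ≡⟨ cong (weight (marked ms) +_) (weight-unmarked-onTimeMarking 0 τ) ⟩
    weight (marked ms) + tardyWeight 0 τ           ∎

maxEarlyWeight⇒isOptimum : ∀ {J′ D A} → All (λ j → d j ≤ D) J′ → MaxEarlyWeight J′ D A →
  IsOptimum J′ (totalWeight J′ ∸ A D)
maxEarlyWeight⇒isOptimum {J′} {D} {A} dues≤D opt with proj₁ (opt D ≤-refl)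
... | S , (U , perm , onTime) , _ , weight≡ =
  (S ++ U , perm , ≤-antisym tardy≤ (lower (S ++ U) perm)) , lower
  where
  open ≤-Reasoning
  lower : ∀ τ → τ ↭ J′ → totalWeight J′ ∸ A D ≤ tardyWeight 0 τ
  lower τ τ↭J′ with schedule⇒earlySubset τ τ↭J′
  ... | E , earlyE , split = begin
    totalWeight J′ ∸ A D                   ≤⟨ ∸-monoʳ-≤ (totalWeight J′) E-bounded ⟩
    totalWeight J′ ∸ weight E              ≡⟨ cong (_∸ weight E) (trans (totalWeight≡weight J′) split) ⟩
    weight E + tardyWeight 0 τ ∸ weight E  ≡⟨ m+n∸m≡n (weight E) (tardyWeight 0 τ) ⟩
    tardyWeight 0 τ                        ∎
    where
    E-bounded : weight E ≤ A D
    E-bounded = proj₂ (opt D ≤-refl) E earlyE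
      (EarlyFrom⇒load≤ 0 E (EarlySubset-All dues≤D earlyE) z≤n (proj₂ (proj₂ earlyE)))
  tardy≤ : tardyWeight 0 (S ++ U) ≤ totalWeight J′ ∸ A D
  tardy≤ = begin
    tardyWeight 0 (S ++ U)          ≤⟨ tardyWeight-++-≤ 0 S U onTime ⟩
    weight U                        ≡⟨ m+n∸m≡n (weight S) (weight U) ⟨
    weight S + weight U ∸ weight S  ≡⟨ cong₂ _∸_ split (sym weight≡) ⟨
    totalWeight J′ ∸ A D            ∎
    where
    split : totalWeight J′ ≡ weight S + weight U
    split = trans (totalWeight≡weight J′) (trans (sym (sum-map-↭ w perm)) (sum-map-++ w S U))

SolvedUpTo : List Job → ℕ × (ℕ → ℕ) → Set
SolvedUpTo I (m , A) = All (λ j → d j ≤ m) I × MaxEarlyWeight I m A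

convLoop-solvedUpTo : ∀ (Jx : ℕ → List Job) sol {I m A} xs → AllPairs _<_ (m ∷ xs) →
  All (λ x → All (λ j → d j ≡ x) (Jx x) × MaxEarlyWeight (Jx x) x (sol x)) xs →
  SolvedUpTo I (m , A) → SolvedUpTo (I ++ concatMap Jx xs) (convLoop sol m A xs)
convLoop-solvedUpTo Jx sol {I} [] _ [] solved =
  subst (λ I′ → SolvedUpTo I′ _) (sym (++-identityʳ I)) solved
convLoop-solvedUpTo Jx sol {I} {m} {A} (x ∷ xs) ((m<x ∷ _) ∷ sorted) ((dues≡x , optx) ∷ classes) (dues≤m , optI) =
  subst (λ I′ → SolvedUpTo I′ (convLoop sol m A (x ∷ xs))) (++-assoc I (Jx x) (concatMap Jx xs))
    (convLoop-solvedUpTo Jx sol xs sorted classes (dues≤x , maxPlusConv-maxEarlyWeight m<x dues≤m dues≡x optI optx))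
  where
  dues≤x : All (λ j → d j ≤ x) (I ++ Jx x)
  dues≤x = All.++⁺ (All.map (λ due≤m → ≤-trans due≤m (<⇒≤ m<x)) dues≤m) (All.map ≤-reflexive dues≡x)

concatMap-jobsWithDue-[] : ∀ ds → concatMap (jobsWithDue []) ds ≡ []
concatMap-jobsWithDue-[] [] = refl
concatMap-jobsWithDue-[] (x ∷ ds) = concatMap-jobsWithDue-[] ds

concatMap-jobsWithDue-∉ : ∀ j J′ {ds} → d j ∉ ds →
  concatMap (jobsWithDue (j ∷ J′)) ds ≡ concatMap (jobsWithDue J′) ds
concatMap-jobsWithDue-∉ j J′ {[]} _ = refl
concatMap-jobsWithDue-∉ j J′ {x ∷ ds} due∉ =
  cong₂ _++_ (filter-reject (λ i → d i ≟ x) (due∉ ∘ here)) (concatMap-jobsWithDue-∉ j J′ (due∉ ∘ there))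

concatMap-jobsWithDue-∈ : ∀ j J′ {ds} → Unique ds → d j ∈ ds →
  concatMap (jobsWithDue (j ∷ J′)) ds ↭ j ∷ concatMap (jobsWithDue J′) ds
concatMap-jobsWithDue-∈ j J′ {x ∷ ds} (x∉ds ∷ unique) (here refl) =
  ↭-reflexive (cong₂ _++_ (filter-accept (λ i → d i ≟ x) refl)
                          (concatMap-jobsWithDue-∉ j J′ (λ x∈ds → All.lookup x∉ds x∈ds refl)))
concatMap-jobsWithDue-∈ j J′ {x ∷ ds} (x∉ds ∷ unique) (there due∈ds) = begin
  concatMap (jobsWithDue (j ∷ J′)) (x ∷ ds)                ≡⟨ cong (_++ _) (filter-reject (λ i → d i ≟ x) due≢x) ⟩
  jobsWithDue J′ x ++ concatMap (jobsWithDue (j ∷ J′)) ds  ↭⟨ ++⁺ˡ (jobsWithDue J′ x) (concatMap-jobsWithDue-∈ j J′ unique due∈ds) ⟩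
  jobsWithDue J′ x ++ j ∷ concatMap (jobsWithDue J′) ds    ↭⟨ shift j (jobsWithDue J′ x) _ ⟩
  j ∷ concatMap (jobsWithDue J′) (x ∷ ds)                  ∎
  where
  open PermutationReasoning
  due≢x : d j ≢ x
  due≢x = All.lookup x∉ds due∈ds ∘ sym

concatMap-jobsWithDue-↭ : ∀ {ds} J′ → Unique ds → All (λ j → d j ∈ ds) J′ → concatMap (jobsWithDue J′) ds ↭ J′
concatMap-jobsWithDue-↭ {ds} [] _ [] = ↭-reflexive (concatMap-jobsWithDue-[] ds)
concatMap-jobsWithDue-↭ (j ∷ J′) unique (due∈ ∷ dues∈) =
  ↭-trans (concatMap-jobsWithDue-∈ j J′ unique due∈) (prep j (concatMap-jobsWithDue-↭ J′ unique dues∈))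

lemma2 : (J : List Job) (d₁ : ℕ) (ds : List ℕ) (sol : ℕ → ℕ → ℕ) →
    IsDistinctDueDates J (d₁ ∷ ds) →
    ((x : ℕ) → x ∈ d₁ ∷ ds → IsSolutionVector (jobsWithDue J x) x (sol x)) →
    IsOptimum J (algorithm1 J d₁ ds sol)
lemma2 J d₁ ds sol (sorted , _ , dueListed) solutionVectors =
  maxEarlyWeight⇒isOptimum (All-resp-↭ partition (proj₁ solved)) (MaxEarlyWeight-resp-↭ partition (proj₂ solved))
  where
  classes : All (λ x → All (λ j → d j ≡ x) (jobsWithDue J x) × MaxEarlyWeight (jobsWithDue J x) x (sol x)) (d₁ ∷ ds)
  classes = All.tabulate λ {x} x∈ → all-filter (λ j → d j ≟ x) J , isSolutionVector⇒maxEarlyWeight (solutionVectors x x∈)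
  solved : SolvedUpTo (concatMap (jobsWithDue J) (d₁ ∷ ds)) (convLoop sol d₁ (sol d₁) ds)
  solved with classes
  ... | (dues≡d₁ , opt₁) ∷ later =
    convLoop-solvedUpTo (jobsWithDue J) sol ds sorted later (All.map ≤-reflexive dues≡d₁ , opt₁)
  partition : concatMap (jobsWithDue J) (d₁ ∷ ds) ↭ J
  partition = concatMap-jobsWithDue-↭ J (AllPairs.map <⇒≢ sorted) (All.tabulate λ j∈J → dueListed _ (∈-map⁺ d j∈J))
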